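{- Let $d\geq1$ and let $a\in\mathbb{Z}^d\setminus\{0\}$ be primitive. Then there exists a matrix $A\in\mathrm{GL}_d(\mathbb{Z})$ whose first column is $a$ and such that $|A|\leq 2^{\max\{0,d-2\}}|a|$.
   Context: $|a|$ denotes the maximum norm of a vector and $|A|=\max_{i,j}|a_{ij}|$ for a matrix $A=(a_{ij})$. A vector $a\in\mathbb{Z}^d\setminus\{0\}$ is primitive if the gcd of its coordinates is $1$. -}

module Defs where

open import Data.Nat as ℕ using (ℕ; zero; suc; _⊔_; _^_; _∸_)
open import Data.Nat.GCD using (gcd)
open import Data.Integer as ℤ using (ℤ; ∣_∣; +_; 0ℤ; 1ℤ)
open import Data.Fin using (Fin; zero; suc)
open import Data.Product using (Σ; _×_)
open import Relation.Binary.PropositionalEquality using (_≡_)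
open import Relation.Nullary using (¬_)

Vecℤ : ℕ → Set
Vecℤ d = Fin d → ℤ

Matℤ : ℕ → Set
Matℤ d = Fin d → Fin d → ℤ

sumℤ : ∀ {n} → (Fin n → ℤ) → ℤ
sumℤ {zero}  f = 0ℤ
sumℤ {suc n} f = f zero ℤ.+ sumℤ (λ i → f (suc i))

maxℕ : ∀ {n} → (Fin n → ℕ) → ℕ
maxℕ {zero}  f = 0
maxℕ {suc n} f = f zero ⊔ maxℕ (λ i → f (suc i))

gcdℕ : ∀ {n} → (Fin n → ℕ) → ℕ
gcdℕ {zero}  f = 0
gcdℕ {suc n} f = gcd (f zero) (gcdℕ (λ i → f (suc i)))

‖_‖ᵥ : ∀ {d} → Vecℤ d → ℕ
‖ a ‖ᵥ = maxℕ (λ i → ∣ a i ∣)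

‖_‖ₘ : ∀ {d} → Matℤ d → ℕ
‖ A ‖ₘ = maxℕ (λ i → maxℕ (λ j → ∣ A i j ∣))

IsZeroVec : ∀ {d} → Vecℤ d → Set
IsZeroVec a = ∀ i → a i ≡ 0ℤ

Primitive : ∀ {d} → Vecℤ d → Set
Primitive a = ¬ IsZeroVec a × gcdℕ (λ i → ∣ a i ∣) ≡ 1

_⊗_ : ∀ {d} → Matℤ d → Matℤ d → Matℤ d
(A ⊗ B) i j = sumℤ (λ k → A i k ℤ.* B k j)

I : ∀ {d} → Matℤ d
I i j with Data.Fin._≟_ i j
... | Relation.Nullary.yes _ = 1ℤ
... | Relation.Nullary.no  _ = 0ℤ
  where open import Data.Fin

InGL : ∀ {d} → Matℤ d → Set
InGL {d} A = Σ (Matℤ d) λ B → ((i j : Fin d) → (A ⊗ B) i j ≡ I i j)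
                              × ((i j : Fin d) → (B ⊗ A) i j ≡ I i j)

-- Write a = (a₀, g·b) with g the gcd of the last coordinates and
-- b primitive (b = e₀ and a₀ = ±1 if g = 0), and complete b to B ∈ GL by induction. As
-- gcd(a₀, g) = 1 there are t, c with a₀t − cg = 1, and reducing t modulo g gives 0 ≤ t < g and
-- |c| ≤ max(|a₀|, 1). The matrix [[a₀, c, 0], [g·b, t·b, B′]] = (1 ⊕ B)·([[a₀, c], [g, t]] ⊕ I),
-- where B′ is B without its first column, is then in GL with first column a, and each of its
-- entries is at most |a|. So in fact |A| ≤ |a|, without the factor 2^(d−2).

module Submission where

open import Defs
open import Data.Nat as ℕ using (ℕ; zero; suc; _≤_; _⊔_; _^_; _∸_; z≤n)
import Data.Nat.Properties as ℕₚ
open import Data.Nat.Divisibility using (_∣_; ∣-trans; ∣⇒≤; 0∣⇒≡0)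
open import Data.Nat.GCD
  using ( gcd; gcd-GCD; module Bézout; gcd[m,n]∣m; gcd[m,n]∣n; gcd-identityˡ; gcd-identityʳ
        ; gcd-zeroˡ; c*gcd[m,n]≡gcd[cm,cn])
open import Data.Fin using (Fin; zero; suc)
open import Data.Fin.Properties using (_≟_)
open import Data.Vec.Functional using (tail)
open import Data.Integer using (ℤ; +_; -[1+_]; ∣_∣; 0ℤ; 1ℤ; _+_; _*_; _-_; -_)
open import Data.Integer.Properties
  using ( +-*-semiring; +-identityˡ; +-identityʳ; *-identityˡ; *-identityʳ; *-zeroʳ; *-assoc
        ; *-comm; pos-+; pos-*; neg-distribˡ-*; neg-distribʳ-*
        ; ∣i-j∣≤∣i∣+∣j∣; ∣i∣≡0⇒i≡0; ∣i*j∣≡∣i∣*∣j∣)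
import Data.Integer.Divisibility.Signed as Signed
open import Data.Integer.DivMod using (_%ℕ_; _/ℕ_; n%ℕd<d; a≡a%ℕn+[a/ℕn]*n)
open import Algebra.Properties.Semiring.Sum +-*-semiring
  using (sum; sum-cong-≗; sum-replicate-zero; ∑-comm; *-distribˡ-sum; *-distribʳ-sum)
open import Data.Integer.Tactic.RingSolver using (solve-∀)
open import Data.Product using (Σ; _×_; _,_)
open import Relation.Binary.Bundles using (Setoid)
open import Relation.Binary.PropositionalEquality
open import Relation.Nullary using (yes; no)

private variable
  m n : ℕ

sumℤ≡sum : (f : Fin n → ℤ) → sumℤ f ≡ sum f
sumℤ≡sum {zero}  f = refl
sumℤ≡sum {suc n} f = cong (_+_ (f zero)) (sumℤ≡sum (tail f))

sumℤ-cong : {f g : Fin n → ℤ} → (∀ i → f i ≡ g i) → sumℤ f ≡ sumℤ g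
sumℤ-cong {f = f} {g} f≗g = trans (sumℤ≡sum f) (trans (sum-cong-≗ f≗g) (sym (sumℤ≡sum g)))

sumℤ-zero : {f : Fin n → ℤ} → (∀ i → f i ≡ 0ℤ) → sumℤ f ≡ 0ℤ
sumℤ-zero {n} f≗0 = trans (sumℤ-cong f≗0) (trans (sumℤ≡sum {n} (λ _ → 0ℤ)) (sum-replicate-zero n))

*-distribˡ-sumℤ : ∀ x (f : Fin n → ℤ) → x * sumℤ f ≡ sumℤ (λ i → x * f i)
*-distribˡ-sumℤ x f =
  trans (cong (x *_) (sumℤ≡sum f)) (trans (*-distribˡ-sum x f) (sym (sumℤ≡sum (λ i → x * f i))))

*-distribʳ-sumℤ : ∀ x (f : Fin n → ℤ) → sumℤ f * x ≡ sumℤ (λ i → f i * x)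
*-distribʳ-sumℤ x f =
  trans (cong (_* x) (sumℤ≡sum f)) (trans (*-distribʳ-sum x f) (sym (sumℤ≡sum (λ i → f i * x))))

sumℤ-comm : (f : Fin m → Fin n → ℤ) →
  sumℤ (λ i → sumℤ (λ j → f i j)) ≡ sumℤ (λ j → sumℤ (λ i → f i j))
sumℤ-comm f = begin
  sumℤ (λ i → sumℤ (f i))             ≡⟨ sumℤ-cong (λ i → sumℤ≡sum (f i)) ⟩
  sumℤ (λ i → sum (f i))              ≡⟨ sumℤ≡sum (λ i → sum (f i)) ⟩
  sum (λ i → sum (f i))               ≡⟨ ∑-comm f ⟩
  sum (λ j → sum (λ i → f i j))       ≡⟨ sumℤ≡sum (λ j → sum (λ i → f i j)) ⟨
  sumℤ (λ j → sum (λ i → f i j))      ≡⟨ sumℤ-cong (λ j → sumℤ≡sum (λ i → f i j)) ⟨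
  sumℤ (λ j → sumℤ (λ i → f i j))     ∎
  where open ≡-Reasoning

infix 4 _≈_

_≈_ : Matℤ n → Matℤ n → Set
A ≈ B = ∀ i j → A i j ≡ B i j

≈-setoid : ℕ → Setoid _ _
≈-setoid n = record
  { Carrier       = Matℤ n
  ; _≈_           = _≈_
  ; isEquivalence = record
    { refl  = λ i j → refl
    ; sym   = λ A≈B i j → sym (A≈B i j)
    ; trans = λ A≈B B≈C i j → trans (A≈B i j) (B≈C i j)
    }
  }

module ≈ {n} = Setoid (≈-setoid n)

I-suc : (i j : Fin n) → I (suc i) (suc j) ≡ I i j
I-suc i j with i ≟ j
... | yes refl = refl
... | no _     = refl

sum-δˡ : (i : Fin n) (f : Fin n → ℤ) → sumℤ (λ k → I i k * f k) ≡ f i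
sum-δˡ {suc n} zero f =
  trans (cong (_+_ (1ℤ * f zero)) (sumℤ-zero {n} (λ _ → refl)))
        (trans (+-identityʳ _) (*-identityˡ (f zero)))
sum-δˡ (suc i) f =
  trans (+-identityˡ _)
        (trans (sumℤ-cong (λ k → cong (_* f (suc k)) (I-suc i k))) (sum-δˡ i (tail f)))

sum-δʳ : (j : Fin n) (f : Fin n → ℤ) → sumℤ (λ k → f k * I k j) ≡ f j
sum-δʳ zero f =
  trans (cong (_+_ (f zero * 1ℤ)) (sumℤ-zero (λ k → *-zeroʳ (f (suc k)))))
        (trans (+-identityʳ _) (*-identityʳ (f zero)))
sum-δʳ (suc j) f =
  trans (cong₂ _+_ (*-zeroʳ (f zero)) (sumℤ-cong (λ k → cong (f (suc k) *_) (I-suc k j))))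
        (trans (+-identityˡ _) (sum-δʳ j (tail f)))

⊗-identityˡ : (A : Matℤ n) → I ⊗ A ≈ A
⊗-identityˡ A i j = sum-δˡ i (λ k → A k j)

⊗-cong : {A A′ B B′ : Matℤ n} → A ≈ A′ → B ≈ B′ → A ⊗ B ≈ A′ ⊗ B′
⊗-cong A≈A′ B≈B′ i j = sumℤ-cong (λ k → cong₂ _*_ (A≈A′ i k) (B≈B′ k j))

⊗-congˡ : (A : Matℤ n) {B B′ : Matℤ n} → B ≈ B′ → A ⊗ B ≈ A ⊗ B′
⊗-congˡ A = ⊗-cong {A = A} ≈.refl

⊗-congʳ : (B : Matℤ n) {A A′ : Matℤ n} → A ≈ A′ → A ⊗ B ≈ A′ ⊗ B
⊗-congʳ B A≈A′ = ⊗-cong {B = B} A≈A′ ≈.refl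

⊗-assoc : (A B C : Matℤ n) → (A ⊗ B) ⊗ C ≈ A ⊗ (B ⊗ C)
⊗-assoc A B C i j = begin
  sumℤ (λ k → sumℤ (λ l → A i l * B l k) * C k j)
    ≡⟨ sumℤ-cong (λ k → *-distribʳ-sumℤ (C k j) (λ l → A i l * B l k)) ⟩
  sumℤ (λ k → sumℤ (λ l → A i l * B l k * C k j))
    ≡⟨ sumℤ-comm (λ k l → A i l * B l k * C k j) ⟩
  sumℤ (λ l → sumℤ (λ k → A i l * B l k * C k j))
    ≡⟨ sumℤ-cong (λ l → sumℤ-cong (λ k → *-assoc (A i l) (B l k) (C k j))) ⟩
  sumℤ (λ l → sumℤ (λ k → A i l * (B l k * C k j)))
    ≡⟨ sumℤ-cong (λ l → *-distribˡ-sumℤ (A i l) (λ k → B l k * C k j)) ⟨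
  sumℤ (λ l → A i l * sumℤ (λ k → B l k * C k j))
    ∎
  where open ≡-Reasoning

InGL-resp-≈ : {A A′ : Matℤ n} → A ≈ A′ → InGL A → InGL A′
InGL-resp-≈ A≈A′ (B , AB≈I , BA≈I) =
  B , ≈.trans (⊗-congʳ B (≈.sym A≈A′)) AB≈I , ≈.trans (⊗-congˡ B (≈.sym A≈A′)) BA≈I

⊗-cancel-middle : (A B B′ A′ : Matℤ n) → B ⊗ B′ ≈ I → (A ⊗ B) ⊗ (B′ ⊗ A′) ≈ A ⊗ A′
⊗-cancel-middle A B B′ A′ BB′≈I = begin
  (A ⊗ B) ⊗ (B′ ⊗ A′)   ≈⟨ ⊗-assoc A B (B′ ⊗ A′) ⟩
  A ⊗ (B ⊗ (B′ ⊗ A′))   ≈⟨ ⊗-congˡ A (≈.sym (⊗-assoc B B′ A′)) ⟩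
  A ⊗ ((B ⊗ B′) ⊗ A′)   ≈⟨ ⊗-congˡ A (⊗-congʳ A′ BB′≈I) ⟩
  A ⊗ (I ⊗ A′)          ≈⟨ ⊗-congˡ A (⊗-identityˡ A′) ⟩
  A ⊗ A′                ∎
  where open import Relation.Binary.Reasoning.Setoid (≈-setoid _)

InGL-⊗ : {A B : Matℤ n} → InGL A → InGL B → InGL (A ⊗ B)
InGL-⊗ {A = A} {B} (A′ , AA′≈I , A′A≈I) (B′ , BB′≈I , B′B≈I) =
  B′ ⊗ A′ ,
  ≈.trans (⊗-cancel-middle A B B′ A′ BB′≈I) AA′≈I ,
  ≈.trans (⊗-cancel-middle B′ A′ A B A′A≈I) B′B≈I

1⊕_ : Matℤ n → Matℤ (suc n)
(1⊕ X) zero    zero    = 1ℤ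
(1⊕ X) zero    (suc j) = 0ℤ
(1⊕ X) (suc i) zero    = 0ℤ
(1⊕ X) (suc i) (suc j) = X i j

1⊕-⊗ : (X Y : Matℤ n) → (1⊕ X) ⊗ (1⊕ Y) ≈ 1⊕ (X ⊗ Y)
1⊕-⊗ {n} X Y zero    zero    = cong (_+_ 1ℤ) (sumℤ-zero {n} (λ _ → refl))
1⊕-⊗ {n} X Y zero    (suc j) = trans (+-identityˡ _) (sumℤ-zero {n} (λ _ → refl))
1⊕-⊗ {n} X Y (suc i) zero    = trans (+-identityˡ _) (sumℤ-zero {n} (λ k → *-zeroʳ (X i k)))
1⊕-⊗ {n} X Y (suc i) (suc j) = +-identityˡ _

1⊕-cong : {X Y : Matℤ n} → X ≈ Y → 1⊕ X ≈ 1⊕ Y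
1⊕-cong X≈Y zero    zero    = refl
1⊕-cong X≈Y zero    (suc j) = refl
1⊕-cong X≈Y (suc i) zero    = refl
1⊕-cong X≈Y (suc i) (suc j) = X≈Y i j

1⊕I≈I : 1⊕ I {n} ≈ I
1⊕I≈I zero    zero    = refl
1⊕I≈I zero    (suc j) = refl
1⊕I≈I (suc i) zero    = refl
1⊕I≈I (suc i) (suc j) = sym (I-suc i j)

InGL-1⊕ : {X : Matℤ n} → InGL X → InGL (1⊕ X)
InGL-1⊕ {X = X} (Y , XY≈I , YX≈I) =
  1⊕ Y ,
  ≈.trans (1⊕-⊗ X Y) (≈.trans (1⊕-cong XY≈I) 1⊕I≈I) ,
  ≈.trans (1⊕-⊗ Y X) (≈.trans (1⊕-cong YX≈I) 1⊕I≈I)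

+-sum-*-zero : ∀ x (f : Fin n → ℤ) → x + sumℤ (λ k → f k * 0ℤ) ≡ x
+-sum-*-zero x f = trans (cong (_+_ x) (sumℤ-zero (λ k → *-zeroʳ (f k)))) (+-identityʳ x)

block₂ : ℤ → ℤ → ℤ → ℤ → Matℤ (suc (suc n))
block₂ p q u v zero          zero          = p
block₂ p q u v zero          (suc zero)    = q
block₂ p q u v (suc zero)    zero          = u
block₂ p q u v (suc zero)    (suc zero)    = v
block₂ p q u v zero          (suc (suc l)) = 0ℤ
block₂ p q u v (suc zero)    (suc (suc l)) = 0ℤ
block₂ p q u v (suc (suc k)) zero          = 0ℤ
block₂ p q u v (suc (suc k)) (suc zero)    = 0ℤ
block₂ p q u v (suc (suc k)) (suc (suc l)) = I k l

combineColumns : Matℤ (suc (suc n)) → ℤ → ℤ → ℤ → ℤ → Matℤ (suc (suc n))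
combineColumns M p q u v i zero          = M i zero * p + M i (suc zero) * u
combineColumns M p q u v i (suc zero)    = M i zero * q + M i (suc zero) * v
combineColumns M p q u v i (suc (suc l)) = M i (suc (suc l))

⊗-block₂ : (M : Matℤ (suc (suc n))) (p q u v : ℤ) →
  M ⊗ block₂ p q u v ≈ combineColumns M p q u v
⊗-block₂ M p q u v i zero =
  cong (_+_ (M i zero * p)) (+-sum-*-zero (M i (suc zero) * u) (λ k → M i (suc (suc k))))
⊗-block₂ M p q u v i (suc zero) =
  cong (_+_ (M i zero * q)) (+-sum-*-zero (M i (suc zero) * v) (λ k → M i (suc (suc k))))
⊗-block₂ M p q u v i (suc (suc l)) = begin
  M i zero * 0ℤ + (M i (suc zero) * 0ℤ + sumℤ (λ k → M i (suc (suc k)) * I k l))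
    ≡⟨ cong₂ _+_ (*-zeroʳ (M i zero))
                 (cong₂ _+_ (*-zeroʳ (M i (suc zero))) (sum-δʳ l (λ k → M i (suc (suc k))))) ⟩
  0ℤ + (0ℤ + M i (suc (suc l)))
    ≡⟨ trans (+-identityˡ _) (+-identityˡ _) ⟩
  M i (suc (suc l)) ∎
  where open ≡-Reasoning

block₂-⊗-block₂ : ∀ (p q u v p′ q′ u′ v′ : ℤ) →
  block₂ {n} p q u v ⊗ block₂ p′ q′ u′ v′ ≈
  block₂ (p * p′ + q * u′) (p * q′ + q * v′) (u * p′ + v * u′) (u * q′ + v * v′)
block₂-⊗-block₂ p q u v p′ q′ u′ v′ =
  ≈.trans (⊗-block₂ (block₂ p q u v) p′ q′ u′ v′) entries
  where
  entries : combineColumns (block₂ p q u v) p′ q′ u′ v′ ≈ block₂ _ _ _ _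
  entries zero          zero          = refl
  entries zero          (suc zero)    = refl
  entries zero          (suc (suc l)) = refl
  entries (suc zero)    zero          = refl
  entries (suc zero)    (suc zero)    = refl
  entries (suc zero)    (suc (suc l)) = refl
  entries (suc (suc k)) zero          = refl
  entries (suc (suc k)) (suc zero)    = refl
  entries (suc (suc k)) (suc (suc l)) = refl

block₂-cong : ∀ {p q u v p′ q′ u′ v′ : ℤ} → p ≡ p′ → q ≡ q′ → u ≡ u′ → v ≡ v′ →
  block₂ {n} p q u v ≈ block₂ p′ q′ u′ v′
block₂-cong refl refl refl refl = ≈.refl

block₂-I : block₂ {n} 1ℤ 0ℤ 0ℤ 1ℤ ≈ I
block₂-I zero          zero          = refl
block₂-I zero          (suc zero)    = refl
block₂-I zero          (suc (suc l)) = refl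
block₂-I (suc zero)    zero          = refl
block₂-I (suc zero)    (suc zero)    = refl
block₂-I (suc zero)    (suc (suc l)) = refl
block₂-I (suc (suc k)) zero          = refl
block₂-I (suc (suc k)) (suc zero)    = refl
block₂-I (suc (suc k)) (suc (suc l)) = sym (trans (I-suc (suc k) (suc l)) (I-suc k l))

InGL-block₂ : ∀ {p q u v : ℤ} → p * v - q * u ≡ 1ℤ → InGL (block₂ {n} p q u v)
InGL-block₂ {p = p} {q} {u} {v} det =
  block₂ v (- q) (- u) p ,
  ≈.trans (block₂-⊗-block₂ p q u v v (- q) (- u) p)
    (≈.trans (block₂-cong (trans (adjʳ₁₁ p q u v) det) (adjʳ₁₂ p q)
                          (adjʳ₂₁ u v) (trans (adjʳ₂₂ p q u v) det))
      block₂-I) ,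
  ≈.trans (block₂-⊗-block₂ v (- q) (- u) p p q u v)
    (≈.trans (block₂-cong (trans (adjˡ₁₁ p q u v) det) (adjˡ₁₂ q v)
                          (adjˡ₂₁ p u) (trans (adjˡ₂₂ p q u v) det))
      block₂-I)
  where
  adjʳ₁₁ : ∀ p q u v → p * v + q * - u ≡ p * v - q * u
  adjʳ₁₁ = solve-∀
  adjʳ₁₂ : ∀ p q → p * - q + q * p ≡ 0ℤ
  adjʳ₁₂ = solve-∀
  adjʳ₂₁ : ∀ u v → u * v + v * - u ≡ 0ℤ
  adjʳ₂₁ = solve-∀
  adjʳ₂₂ : ∀ p q u v → u * - q + v * p ≡ p * v - q * u
  adjʳ₂₂ = solve-∀
  adjˡ₁₁ : ∀ p q u v → v * p + - q * u ≡ p * v - q * u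
  adjˡ₁₁ = solve-∀
  adjˡ₁₂ : ∀ q v → v * q + - q * v ≡ 0ℤ
  adjˡ₁₂ = solve-∀
  adjˡ₂₁ : ∀ p u → - u * p + p * u ≡ 0ℤ
  adjˡ₂₁ = solve-∀
  adjˡ₂₂ : ∀ p q u v → - u * q + p * v ≡ p * v - q * u
  adjˡ₂₂ = solve-∀

border : Matℤ (suc n) → (a₀ c g t : ℤ) → Matℤ (suc (suc n))
border B a₀ c g t zero    zero          = a₀
border B a₀ c g t zero    (suc zero)    = c
border B a₀ c g t zero    (suc (suc l)) = 0ℤ
border B a₀ c g t (suc i) zero          = B i zero * g
border B a₀ c g t (suc i) (suc zero)    = B i zero * t
border B a₀ c g t (suc i) (suc (suc l)) = B i (suc l)

1⊕-⊗-block₂≈border : (B : Matℤ (suc n)) (a₀ c g t : ℤ) →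
  (1⊕ B) ⊗ block₂ a₀ c g t ≈ border B a₀ c g t
1⊕-⊗-block₂≈border B a₀ c g t = ≈.trans (⊗-block₂ (1⊕ B) a₀ c g t) entries
  where
  entries : combineColumns (1⊕ B) a₀ c g t ≈ border B a₀ c g t
  entries zero    zero          = trans (+-identityʳ _) (*-identityˡ a₀)
  entries zero    (suc zero)    = trans (+-identityʳ _) (*-identityˡ c)
  entries zero    (suc (suc l)) = refl
  entries (suc i) zero          = +-identityˡ _
  entries (suc i) (suc zero)    = +-identityˡ _
  entries (suc i) (suc (suc l)) = refl

InGL-border : {B : Matℤ (suc n)} {a₀ c g t : ℤ} →
  InGL B → a₀ * t - c * g ≡ 1ℤ → InGL (border B a₀ c g t)
InGL-border {B = B} {a₀} {c} {g} {t} B∈GL det =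
  InGL-resp-≈ (1⊕-⊗-block₂≈border B a₀ c g t)
    (InGL-⊗ {A = 1⊕ B} {B = block₂ a₀ c g t} (InGL-1⊕ B∈GL) (InGL-block₂ det))

≤-maxℕ : (f : Fin n → ℕ) (i : Fin n) → f i ≤ maxℕ f
≤-maxℕ f zero    = ℕₚ.m≤m⊔n _ _
≤-maxℕ f (suc i) = ℕₚ.≤-trans (≤-maxℕ (tail f) i) (ℕₚ.m≤n⊔m _ _)

maxℕ-lub : ∀ (f : Fin n → ℕ) {N} → (∀ i → f i ≤ N) → maxℕ f ≤ N
maxℕ-lub {zero}  f f≤N = z≤n
maxℕ-lub {suc n} f f≤N = ℕₚ.⊔-lub (f≤N zero) (maxℕ-lub (tail f) (λ i → f≤N (suc i)))

∣aᵢ∣≤‖a‖ᵥ : (a : Vecℤ n) (i : Fin n) → ∣ a i ∣ ≤ ‖ a ‖ᵥ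
∣aᵢ∣≤‖a‖ᵥ a = ≤-maxℕ (λ i → ∣ a i ∣)

∣Aᵢⱼ∣≤‖A‖ₘ : (A : Matℤ n) (i j : Fin n) → ∣ A i j ∣ ≤ ‖ A ‖ₘ
∣Aᵢⱼ∣≤‖A‖ₘ A i j = ℕₚ.≤-trans (∣aᵢ∣≤‖a‖ᵥ (A i) j) (≤-maxℕ (λ i → ‖ A i ‖ᵥ) i)

‖‖ₘ-lub : ∀ (A : Matℤ n) {N} → (∀ i j → ∣ A i j ∣ ≤ N) → ‖ A ‖ₘ ≤ N
‖‖ₘ-lub A A≤N = maxℕ-lub _ (λ i → maxℕ-lub _ (A≤N i))

‖border‖ₘ≤ : ∀ (B : Matℤ (suc n)) (a₀ c g t : ℤ) {N} →
  ∣ a₀ ∣ ≤ N → ∣ c ∣ ≤ N → (∀ i → ∣ B i zero * g ∣ ≤ N) → (∀ i → ∣ B i zero * t ∣ ≤ N) →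
  ‖ B ‖ₘ ≤ N → ‖ border B a₀ c g t ‖ₘ ≤ N
‖border‖ₘ≤ B a₀ c g t {N} ∣a₀∣≤N ∣c∣≤N ∣Bg∣≤N ∣Bt∣≤N ‖B‖≤N =
  ‖‖ₘ-lub (border B a₀ c g t) entry≤N
  where
  entry≤N : ∀ i j → ∣ border B a₀ c g t i j ∣ ≤ N
  entry≤N zero    zero          = ∣a₀∣≤N
  entry≤N zero    (suc zero)    = ∣c∣≤N
  entry≤N zero    (suc (suc l)) = z≤n
  entry≤N (suc i) zero          = ∣Bg∣≤N i
  entry≤N (suc i) (suc zero)    = ∣Bt∣≤N i
  entry≤N (suc i) (suc (suc l)) = ℕₚ.≤-trans (∣Aᵢⱼ∣≤‖A‖ₘ B i (suc l)) ‖B‖≤N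

gcdℕ-∣ : (f : Fin n → ℕ) (i : Fin n) → gcdℕ f ∣ f i
gcdℕ-∣ f zero    = gcd[m,n]∣m (f zero) (gcdℕ (tail f))
gcdℕ-∣ f (suc i) = ∣-trans (gcd[m,n]∣n (f zero) (gcdℕ (tail f))) (gcdℕ-∣ (tail f) i)

gcdℕ-cong : {f g : Fin n → ℕ} → (∀ i → f i ≡ g i) → gcdℕ f ≡ gcdℕ g
gcdℕ-cong {zero}  f≗g = refl
gcdℕ-cong {suc n} f≗g = cong₂ gcd (f≗g zero) (gcdℕ-cong (λ i → f≗g (suc i)))

c*gcdℕ[f]≡gcdℕ[c*f] : ∀ c (f : Fin n → ℕ) → c ℕ.* gcdℕ f ≡ gcdℕ (λ i → c ℕ.* f i)
c*gcdℕ[f]≡gcdℕ[c*f] {zero}  c f = ℕₚ.*-zeroʳ c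
c*gcdℕ[f]≡gcdℕ[c*f] {suc n} c f =
  trans (c*gcd[m,n]≡gcd[cm,cn] c (f zero) (gcdℕ (tail f)))
        (cong (gcd (c ℕ.* f zero)) (c*gcdℕ[f]≡gcdℕ[c*f] c (tail f)))

gcdℕ≡0⇒f≡0 : (f : Fin n → ℕ) → gcdℕ f ≡ 0 → ∀ i → f i ≡ 0
gcdℕ≡0⇒f≡0 f gcd≡0 i = 0∣⇒≡0 (subst (_∣ f i) gcd≡0 (gcdℕ-∣ f i))

gcdℕ≤maxℕ : (f : Fin n → ℕ) → gcdℕ f ≤ maxℕ f
gcdℕ≤maxℕ {zero}  f = z≤n
gcdℕ≤maxℕ {suc n} f = gcd≤⊔ (f zero) (gcdℕ≤maxℕ (tail f))
  where
  gcd≤⊔ : ∀ x {G M} → G ≤ M → gcd x G ≤ x ⊔ M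
  gcd≤⊔ zero      {G} {M} G≤M = subst (_≤ M) (sym (gcd-identityˡ G)) G≤M
  gcd≤⊔ x@(suc _) {G} {M} G≤M = ℕₚ.≤-trans (∣⇒≤ (gcd[m,n]∣m x G)) (ℕₚ.m≤m⊔n x M)

primitivePart : (v : Vecℤ (suc n)) →
  Σ (Vecℤ (suc n)) λ b →
    (∀ i → v i ≡ b i * + gcdℕ (λ i → ∣ v i ∣)) × gcdℕ (λ i → ∣ b i ∣) ≡ 1 ×
    (∀ i → ∣ b i ∣ ≤ ∣ v i ∣ ⊔ 1)
primitivePart v with gcdℕ (λ i → ∣ v i ∣) in gcd≡g
... | zero = e₀ , v≡0 , gcd-zeroˡ (gcdℕ (λ i → ∣ e₀ (suc i) ∣)) , ∣e₀∣≤1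
  where
  e₀ : Vecℤ _
  e₀ zero    = 1ℤ
  e₀ (suc _) = 0ℤ
  v≡0 : ∀ i → v i ≡ e₀ i * + 0
  v≡0 i = trans (∣i∣≡0⇒i≡0 (gcdℕ≡0⇒f≡0 (λ i → ∣ v i ∣) gcd≡g i)) (sym (*-zeroʳ (e₀ i)))
  ∣e₀∣≤1 : ∀ i → ∣ e₀ i ∣ ≤ ∣ v i ∣ ⊔ 1
  ∣e₀∣≤1 zero    = ℕₚ.m≤n⊔m _ 1
  ∣e₀∣≤1 (suc _) = z≤n
... | g@(suc _) = b , v≡bg , gcd[b]≡1 , ∣b∣≤∣v∣
  where
  g∣v : ∀ i → (+ g) Signed.∣ v i
  g∣v i = Signed.∣ᵤ⇒∣ (subst (_∣ ∣ v i ∣) gcd≡g (gcdℕ-∣ (λ i → ∣ v i ∣) i))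
  b : Vecℤ _
  b i = Signed.quotient (g∣v i)
  v≡bg : ∀ i → v i ≡ b i * + g
  v≡bg i = Signed._∣_.equality (g∣v i)
  ∣v∣≡g*∣b∣ : ∀ i → ∣ v i ∣ ≡ g ℕ.* ∣ b i ∣
  ∣v∣≡g*∣b∣ i = trans (cong ∣_∣ (v≡bg i)) (trans (∣i*j∣≡∣i∣*∣j∣ (b i) (+ g)) (ℕₚ.*-comm ∣ b i ∣ g))
  gcd[b]≡1 : gcdℕ (λ i → ∣ b i ∣) ≡ 1
  gcd[b]≡1 = ℕₚ.*-cancelˡ-≡ _ 1 g (begin
    g ℕ.* gcdℕ (λ i → ∣ b i ∣)     ≡⟨ c*gcdℕ[f]≡gcdℕ[c*f] g (λ i → ∣ b i ∣) ⟩
    gcdℕ (λ i → g ℕ.* ∣ b i ∣)     ≡⟨ gcdℕ-cong ∣v∣≡g*∣b∣ ⟨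
    gcdℕ (λ i → ∣ v i ∣)           ≡⟨ gcd≡g ⟩
    g                              ≡⟨ ℕₚ.*-identityʳ g ⟨
    g ℕ.* 1                        ∎)
    where open ≡-Reasoning
  ∣b∣≤∣v∣ : ∀ i → ∣ b i ∣ ≤ ∣ v i ∣ ⊔ 1
  ∣b∣≤∣v∣ i = ℕₚ.≤-trans (ℕₚ.m≤n*m ∣ b i ∣ g)
                (ℕₚ.≤-trans (ℕₚ.≤-reflexive (sym (∣v∣≡g*∣b∣ i))) (ℕₚ.m≤m⊔n _ 1))

1+a*b≡c*d⇒ℤ : ∀ a b c d → 1 ℕ.+ a ℕ.* b ≡ c ℕ.* d → 1ℤ + + a * + b ≡ + c * + d
1+a*b≡c*d⇒ℤ a b c d eq = begin
  1ℤ + + a * + b      ≡⟨ cong (_+_ 1ℤ) (pos-* a b) ⟨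
  1ℤ + + (a ℕ.* b)    ≡⟨ pos-+ 1 (a ℕ.* b) ⟨
  + (1 ℕ.+ a ℕ.* b)   ≡⟨ cong +_ eq ⟩
  + (c ℕ.* d)         ≡⟨ pos-* c d ⟩
  + c * + d           ∎
  where open ≡-Reasoning

1+b≡a⇒a-b≡1 : ∀ {a b} → 1ℤ + b ≡ a → a - b ≡ 1ℤ
1+b≡a⇒a-b≡1 {a} {b} eq = trans (cong (_- b) (sym eq)) (1+b-b≡1 b)
  where
  1+b-b≡1 : ∀ b → 1ℤ + b - b ≡ 1ℤ
  1+b-b≡1 = solve-∀

∣i∣≡1⇒i*i≡1 : ∀ x → ∣ x ∣ ≡ 1 → x * x ≡ 1ℤ
∣i∣≡1⇒i*i≡1 (+ 1)      refl = refl
∣i∣≡1⇒i*i≡1 -[1+ 0 ]   refl = refl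

bezoutℕ : ∀ m g → gcd m g ≡ 1 → Σ ℤ λ s → Σ ℤ λ c → + m * s - c * + g ≡ 1ℤ
bezoutℕ m g gcd≡1 with subst (λ d → Bézout.Identity d m g) gcd≡1 (Bézout.identity (gcd-GCD m g))
... | Bézout.+- x y eq =
  + x , + y ,
  trans (cong (_- + y * + g) (*-comm (+ m) (+ x))) (1+b≡a⇒a-b≡1 (1+a*b≡c*d⇒ℤ y g x m eq))
... | Bézout.-+ x y eq =
  - + x , - + y ,
  trans (swap (+ m) (+ x) (+ y) (+ g)) (1+b≡a⇒a-b≡1 (1+a*b≡c*d⇒ℤ x m y g eq))
  where
  swap : ∀ m x y g → m * - x - - y * g ≡ y * g - x * m
  swap = solve-∀

bezoutℤ : ∀ x g → gcd ∣ x ∣ g ≡ 1 → Σ ℤ λ s → Σ ℤ λ c → x * s - c * + g ≡ 1ℤ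
bezoutℤ (+ m)      g gcd≡1 = bezoutℕ m g gcd≡1
bezoutℤ -[1+ m ] g gcd≡1 with bezoutℕ (suc m) g gcd≡1
... | s , c , det =
  - s , c , trans (cong (_- c * + g) x*-s≡-x*s) det
  where
  x*-s≡-x*s : -[1+ m ] * - s ≡ + suc m * s
  x*-s≡-x*s = trans (sym (neg-distribʳ-* -[1+ m ] s)) (neg-distribˡ-* -[1+ m ] s)

-- Reducing s modulo g to t ∈ [0, g) forces |c| ≤ max(|x|, 1), since c·g = x·t − 1.
bezout-reduced : ∀ x h → gcd ∣ x ∣ (suc h) ≡ 1 →
  Σ ℕ λ t → Σ ℤ λ c → x * + t - c * + suc h ≡ 1ℤ × t ≤ h × ∣ c ∣ ≤ ∣ x ∣ ⊔ 1
bezout-reduced x h gcd≡1 with bezoutℤ x (suc h) gcd≡1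
... | s , c₀ , det₀ = t , c , det , t≤h , ∣c∣≤K
  where
  g = suc h
  t = s %ℕ g
  q = s /ℕ g
  c = c₀ - x * q
  K = ∣ x ∣ ⊔ 1
  t≤h : t ≤ h
  t≤h = ℕₚ.≤-pred (n%ℕd<d s g)
  shift : ∀ x t q c₀ g → x * t - (c₀ - x * q) * g ≡ x * (t + q * g) - c₀ * g
  shift = solve-∀
  det : x * + t - c * + g ≡ 1ℤ
  det = trans (shift x (+ t) q c₀ (+ g))
              (trans (cong (λ s → x * s - c₀ * + g) (sym (a≡a%ℕn+[a/ℕn]*n s g))) det₀)
  c*g≡x*t-[x*t-c*g] : ∀ x t c g → c * g ≡ x * t - (x * t - c * g)
  c*g≡x*t-[x*t-c*g] = solve-∀
  c*g≡x*t-1 : c * + g ≡ x * + t - 1ℤ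
  c*g≡x*t-1 = trans (c*g≡x*t-[x*t-c*g] x (+ t) c (+ g)) (cong (_-_ (x * + t)) det)
  ∣c∣*g≤K*g : ∣ c ∣ ℕ.* g ≤ K ℕ.* g
  ∣c∣*g≤K*g = begin
    ∣ c ∣ ℕ.* g                 ≡⟨ ∣i*j∣≡∣i∣*∣j∣ c (+ g) ⟨
    ∣ c * + g ∣                 ≡⟨ cong ∣_∣ c*g≡x*t-1 ⟩
    ∣ x * + t - 1ℤ ∣            ≤⟨ ∣i-j∣≤∣i∣+∣j∣ (x * + t) 1ℤ ⟩
    ∣ x * + t ∣ ℕ.+ 1           ≡⟨ cong (ℕ._+ 1) (∣i*j∣≡∣i∣*∣j∣ x (+ t)) ⟩
    ∣ x ∣ ℕ.* t ℕ.+ 1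
      ≤⟨ ℕₚ.+-mono-≤ (ℕₚ.*-mono-≤ (ℕₚ.m≤m⊔n ∣ x ∣ 1) t≤h) (ℕₚ.m≤n⊔m ∣ x ∣ 1) ⟩
    K ℕ.* h ℕ.+ K               ≡⟨ ℕₚ.+-comm (K ℕ.* h) K ⟩
    K ℕ.+ K ℕ.* h               ≡⟨ ℕₚ.*-suc K h ⟨
    K ℕ.* g                     ∎
    where open ℕₚ.≤-Reasoning
  ∣c∣≤K : ∣ c ∣ ≤ K
  ∣c∣≤K = ℕₚ.*-cancelʳ-≤ ∣ c ∣ K g ∣c∣*g≤K*g

bezout-bounded : ∀ x g → gcd ∣ x ∣ g ≡ 1 →
  Σ ℤ λ t → Σ ℤ λ c → x * t - c * + g ≡ 1ℤ × ∣ t ∣ ≤ g ⊔ 1 × ∣ c ∣ ≤ ∣ x ∣ ⊔ 1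
bezout-bounded x zero gcd≡1 =
  x , 0ℤ , trans (+-identityʳ (x * x)) (∣i∣≡1⇒i*i≡1 x ∣x∣≡1) , ℕₚ.≤-reflexive ∣x∣≡1 , z≤n
  where
  ∣x∣≡1 : ∣ x ∣ ≡ 1
  ∣x∣≡1 = trans (sym (gcd-identityʳ ∣ x ∣)) gcd≡1
bezout-bounded x (suc h) gcd≡1 with bezout-reduced x h gcd≡1
... | t , c , det , t≤h , ∣c∣≤ =
  + t , c , det , ℕₚ.≤-trans (ℕₚ.m≤n⇒m≤1+n t≤h) (ℕₚ.m≤m⊔n (suc h) 1) , ∣c∣≤

record Completion (a : Vecℤ (suc n)) : Set where
  field
    matrix      : Matℤ (suc n)
    inGL        : InGL matrix
    firstColumn : ∀ i → matrix i zero ≡ a i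
    bounded     : ‖ matrix ‖ₘ ≤ ‖ a ‖ᵥ

extendCompletion : (a : Vecℤ (suc (suc n))) (b : Vecℤ (suc n)) (g : ℕ) →
  (∀ i → a (suc i) ≡ b i * + g) → (∀ i → ∣ b i ∣ ≤ ∣ a (suc i) ∣ ⊔ 1) →
  1 ≤ ‖ a ‖ᵥ → gcd ∣ a zero ∣ g ≡ 1 → Completion b → Completion a
extendCompletion a b g a≡bg ∣b∣≤ 1≤N gcd≡1 B-completion
  with bezout-bounded (a zero) g gcd≡1
... | t , c , det , ∣t∣≤g⊔1 , ∣c∣≤ = record
  { matrix      = border B (a zero) c (+ g) t
  ; inGL        = InGL-border inGL det
  ; firstColumn = λ { zero → refl ; (suc i) → Bᵢ₀*g≡aᵢ₊₁ i }
  ; bounded     = ‖border‖ₘ≤ B (a zero) c (+ g) t (∣aᵢ∣≤N zero) ∣c∣≤N ∣Bᵢ₀*g∣≤N ∣Bᵢ₀*t∣≤N ‖B‖≤N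
  }
  where
  open Completion B-completion renaming (matrix to B)
  N = ‖ a ‖ᵥ
  ∣aᵢ∣≤N : ∀ i → ∣ a i ∣ ≤ N
  ∣aᵢ∣≤N = ∣aᵢ∣≤‖a‖ᵥ a
  ∣bᵢ∣≤N : ∀ i → ∣ b i ∣ ≤ N
  ∣bᵢ∣≤N i = ℕₚ.≤-trans (∣b∣≤ i) (ℕₚ.⊔-lub (∣aᵢ∣≤N (suc i)) 1≤N)
  Bᵢ₀*g≡aᵢ₊₁ : ∀ i → B i zero * + g ≡ a (suc i)
  Bᵢ₀*g≡aᵢ₊₁ i = trans (cong (_* + g) (firstColumn i)) (sym (a≡bg i))
  ∣c∣≤N : ∣ c ∣ ≤ N
  ∣c∣≤N = ℕₚ.≤-trans ∣c∣≤ (ℕₚ.⊔-lub (∣aᵢ∣≤N zero) 1≤N)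
  ∣Bᵢ₀*g∣≤N : ∀ i → ∣ B i zero * + g ∣ ≤ N
  ∣Bᵢ₀*g∣≤N i = subst (λ x → ∣ x ∣ ≤ N) (sym (Bᵢ₀*g≡aᵢ₊₁ i)) (∣aᵢ∣≤N (suc i))
  ‖B‖≤N : ‖ B ‖ₘ ≤ N
  ‖B‖≤N = ℕₚ.≤-trans bounded (maxℕ-lub (λ i → ∣ b i ∣) ∣bᵢ∣≤N)
  ∣bᵢ*t∣≤N : ∀ i → ∣ b i * t ∣ ≤ N
  ∣bᵢ*t∣≤N i = begin
    ∣ b i * t ∣                              ≡⟨ ∣i*j∣≡∣i∣*∣j∣ (b i) t ⟩
    ∣ b i ∣ ℕ.* ∣ t ∣                         ≤⟨ ℕₚ.*-monoʳ-≤ ∣ b i ∣ ∣t∣≤g⊔1 ⟩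
    ∣ b i ∣ ℕ.* (g ⊔ 1)                       ≡⟨ ℕₚ.*-distribˡ-⊔ ∣ b i ∣ g 1 ⟩
    ∣ b i ∣ ℕ.* g ⊔ ∣ b i ∣ ℕ.* 1
      ≡⟨ cong₂ _⊔_ (sym (∣i*j∣≡∣i∣*∣j∣ (b i) (+ g))) (ℕₚ.*-identityʳ ∣ b i ∣) ⟩
    ∣ b i * + g ∣ ⊔ ∣ b i ∣                   ≡⟨ cong (λ x → ∣ x ∣ ⊔ ∣ b i ∣) (a≡bg i) ⟨
    ∣ a (suc i) ∣ ⊔ ∣ b i ∣                   ≤⟨ ℕₚ.⊔-lub (∣aᵢ∣≤N (suc i)) (∣bᵢ∣≤N i) ⟩
    N                                         ∎
    where open ℕₚ.≤-Reasoning
  ∣Bᵢ₀*t∣≤N : ∀ i → ∣ B i zero * t ∣ ≤ N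
  ∣Bᵢ₀*t∣≤N i = subst (λ x → ∣ x * t ∣ ≤ N) (sym (firstColumn i)) (∣bᵢ*t∣≤N i)

completion : ∀ n (a : Vecℤ (suc n)) → gcdℕ (λ i → ∣ a i ∣) ≡ 1 → Completion a
completion zero a gcd≡1 = record
  { matrix      = A
  ; inGL        = A , A⊗A≈I , A⊗A≈I
  ; firstColumn = λ { zero → refl }
  ; bounded     = ‖‖ₘ-lub A (λ { zero zero → ∣aᵢ∣≤‖a‖ᵥ a zero })
  }
  where
  A : Matℤ 1
  A _ _ = a zero
  A⊗A≈I : A ⊗ A ≈ I
  A⊗A≈I zero zero =
    trans (+-identityʳ _) (∣i∣≡1⇒i*i≡1 (a zero) (trans (sym (gcd-identityʳ ∣ a zero ∣)) gcd≡1))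
completion (suc n) a gcd≡1 with primitivePart (tail a)
... | b , a≡bg , gcd[b]≡1 , ∣b∣≤ =
  extendCompletion a b _ a≡bg ∣b∣≤ (subst (_≤ ‖ a ‖ᵥ) gcd≡1 (gcdℕ≤maxℕ (λ i → ∣ a i ∣))) gcd≡1
    (completion n b gcd[b]≡1)

lemmaA6 : (n : ℕ) → (a : Vecℤ (suc n)) → Primitive a →
    Σ (Matℤ (suc n)) λ A → InGL A × ((i : Fin (suc n)) → A i zero ≡ a i)
      × (‖ A ‖ₘ ≤ 2 ^ (suc n ∸ 2) ℕ.* ‖ a ‖ᵥ)
lemmaA6 n a (_ , gcd≡1) =
  matrix , inGL , firstColumn ,
  ℕₚ.≤-trans bounded (ℕₚ.m≤n*m ‖ a ‖ᵥ (2 ^ (suc n ∸ 2)) {{ℕₚ.m^n≢0 2 (suc n ∸ 2)}})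
  where open Completion (completion n a gcd≡1)
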